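{- Let $A_n$ be a path-reversible stream automaton over $[1,n]$ with initial configuration $o$ and set $C$ of configurations reachable from $o$. For $f\in\mathbb{Z}^n$ let $\phi(f)=\{s : \exists\sigma,\ o\oplus\sigma=s,\ \mathrm{freq}\,\sigma=f\}$, let $M=\{f\in\mathbb{Z}^n : o\in\phi(f)\}$, and for $s,t\in C$ write $s\sim t$ if there exists $f\in\mathbb{Z}^n$ with $s,t\in\phi(f)$. Then: 1. $M$ is a sub-module of $\mathbb{Z}^n$. 2. If $f-g\in M$ then $\phi(f)=\phi(g)$; and if $\phi(f)\cap\phi(g)\neq\emptyset$ then $f-g\in M$. 3. $\sim$ is an equivalence relation on $C$. 4. The map $[s]\mapsto f+M$, for $s\in\phi(f)$ (where $[s]$ is the $\sim$-class of $s$), is well-defined, one-to-one and onto $\mathbb{Z}^n/M$.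
   Context: A stream over $[1,n]$ is a finite sequence of records $\pm e_i$ ($e_i$ standard basis vectors of $\mathbb{Z}^n$); $\mathrm{freq}\,\sigma$ is the sum of its records; $\sigma\circ\tau$ is concatenation. The inverse stream $\sigma^r$ is defined by $e_i^r=-e_i$, $(-e_i)^r=e_i$, $(\sigma\circ\tau)^r=\tau^r\circ\sigma^r$. A stream automaton is a deterministic Turing machine with finite control, a work tape and a one-way input tape holding the stream; processing record $v$ from configuration $a$ yields $a\oplus v$, extended left-associatively to streams. It is path reversible if for every stream $\sigma$ and configuration $s$, $s\oplus(\sigma\circ\sigma^r)=s$. -}

module Defs where

open import Data.Nat using (ℕ)
open import Data.Integer as ℤ using (ℤ)
open import Data.Fin using (Fin)
open import Data.Vec using (Vec; replicate; zipWith; map; _[_]%=_)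
open import Data.List using (List; []; _∷_; _++_; [_]; foldl)
open import Data.Product using (Σ; ∃; _×_; _,_)
open import Relation.Binary.PropositionalEquality using (_≡_)

ℤ^ : ℕ → Set
ℤ^ n = Vec ℤ n

0ᵥ : ∀ {n} → ℤ^ n
0ᵥ = replicate _ (ℤ.+ 0)

_+ᵥ_ : ∀ {n} → ℤ^ n → ℤ^ n → ℤ^ n
_+ᵥ_ = zipWith ℤ._+_

-ᵥ_ : ∀ {n} → ℤ^ n → ℤ^ n
-ᵥ_ = map (λ x → ℤ.- x)

_-ᵥ_ : ∀ {n} → ℤ^ n → ℤ^ n → ℤ^ n
f -ᵥ g = f +ᵥ (-ᵥ g)

_·ᵥ_ : ∀ {n} → ℤ → ℤ^ n → ℤ^ n
k ·ᵥ f = map (k ℤ.*_) f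

-- A record of a stream over [1,n]: +e_i or -e_i
data Sign : Set where
  plus minus : Sign

Record : ℕ → Set
Record n = Sign × Fin n

vecOf : ∀ {n} → Record n → ℤ^ n
vecOf (plus  , i) = 0ᵥ [ i ]%= λ _ → ℤ.+ 1
vecOf (minus , i) = 0ᵥ [ i ]%= λ _ → ℤ.- (ℤ.+ 1)

negRec : ∀ {n} → Record n → Record n
negRec (plus  , i) = minus , i
negRec (minus , i) = plus  , i

Stream : ℕ → Set
Stream n = List (Record n)

freq : ∀ {n} → Stream n → ℤ^ n
freq []      = 0ᵥ
freq (v ∷ σ) = vecOf v +ᵥ freq σ

inv : ∀ {n} → Stream n → Stream n
inv []      = []
inv (v ∷ σ) = inv σ ++ [ negRec v ]

-- A stream automaton, abstracted as a deterministic transition system on its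
-- configurations: a ⊕ v is the configuration after processing record v.
record StreamAutomaton (n : ℕ) : Set₁ where
  field
    Config : Set
    _⊕_    : Config → Record n → Config

  _⊕*_ : Config → Stream n → Config
  s ⊕* σ = foldl _⊕_ s σ

  PathReversible : Set
  PathReversible = ∀ (σ : Stream n) (s : Config) → s ⊕* (σ ++ inv σ) ≡ s

  module WithInit (o : Config) where
    Reachable : Config → Set
    Reachable s = ∃ λ (σ : Stream n) → o ⊕* σ ≡ s

    _∈φ_ : Config → ℤ^ n → Set
    s ∈φ f = ∃ λ (σ : Stream n) → (o ⊕* σ ≡ s) × (freq σ ≡ f)

    InM : ℤ^ n → Set
    InM f = o ∈φ f

    _∼_ : Config → Config → Set
    s ∼ t = ∃ λ (f : ℤ^ n) → (s ∈φ f) × (t ∈φ f)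

{-# OPTIONS --safe #-}
-- Path reversibility makes every run invertible: if o ⊕ σ = s then s ⊕ σʳ = o, and
-- freq σʳ = − freq σ. Hence the loop frequencies M at o form a subgroup of ℤⁿ (so a
-- ℤ-submodule), prefixing a loop of frequency h moves φ(f) into φ(h + f), and two runs
-- σ, τ from o to the same s close up to the loop σ ∘ τʳ of frequency f − g. All four
-- claims follow from these two moves; ontoness because every vector is a frequency.
module Submission where

open import Defs
open import Algebra.Bundles using (AbelianGroup)
open import Algebra.Structures using (IsAbelianGroup)
import Algebra.Properties.AbelianGroup as AbelianGroupProperties
open import Data.Nat using (ℕ; zero; suc)
open import Data.Integer as ℤ using (ℤ; +_; -[1+_])
import Data.Integer.Properties as ℤₚ
open import Data.Fin using (zero; suc)
open import Data.Vec using ([]; _∷_; replicate; map; _[_]%=_)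
open import Data.Vec.Properties
  using (zipWith-assoc; zipWith-identityˡ; zipWith-identityʳ; zipWith-inverseˡ; zipWith-inverseʳ;
         zipWith-comm; map-cong; map-const; map-∘; map-replicate; map-updateAt)
open import Data.List as List using ([]; _∷_; _++_; [_])
open import Data.List.Properties using (foldl-++)
open import Data.Product using (∃; _×_; _,_)
open import Function.Base using (const; _∘′_)
open import Function.Bundles using (_⇔_; mk⇔)
open import Level using (0ℓ)
open import Relation.Binary.PropositionalEquality
  using (_≡_; refl; sym; trans; cong; cong₂; subst; isEquivalence; module ≡-Reasoning)

+ᵥ-isAbelianGroup : ∀ n → IsAbelianGroup _≡_ (_+ᵥ_ {n}) 0ᵥ (λ f → -ᵥ f)
+ᵥ-isAbelianGroup n = record
  { isGroup = record
    { isMonoid = record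
      { isSemigroup = record
        { isMagma = record { isEquivalence = isEquivalence ; ∙-cong = cong₂ _+ᵥ_ }
        ; assoc   = zipWith-assoc ℤₚ.+-assoc
        }
      ; identity = zipWith-identityˡ ℤₚ.+-identityˡ , zipWith-identityʳ ℤₚ.+-identityʳ
      }
    ; inverse = zipWith-inverseˡ ℤₚ.+-inverseˡ , zipWith-inverseʳ ℤₚ.+-inverseʳ
    ; ⁻¹-cong = cong (λ f → -ᵥ f)
    }
  ; comm = zipWith-comm ℤₚ.+-comm
  }

+ᵥ-abelianGroup : ℕ → AbelianGroup 0ℓ 0ℓ
+ᵥ-abelianGroup n = record { isAbelianGroup = +ᵥ-isAbelianGroup n }

module ℤ^ {n : ℕ} where
  open IsAbelianGroup (+ᵥ-isAbelianGroup n) public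
  open AbelianGroupProperties (+ᵥ-abelianGroup n) public

·ᵥ-zeroˡ : ∀ {n} (f : ℤ^ n) → (+ 0) ·ᵥ f ≡ 0ᵥ
·ᵥ-zeroˡ f = map-const f (+ 0)

·ᵥ-zeroʳ : ∀ {n} k → k ·ᵥ 0ᵥ {n} ≡ 0ᵥ
·ᵥ-zeroʳ {n} k = trans (map-replicate (k ℤ.*_) (+ 0) n) (cong (replicate n) (ℤₚ.*-zeroʳ k))

suc-·ᵥ : ∀ {n} m (f : ℤ^ n) → (+ suc m) ·ᵥ f ≡ f +ᵥ ((+ m) ·ᵥ f)
suc-·ᵥ m []      = refl
suc-·ᵥ m (x ∷ f) = cong₂ _∷_ (ℤₚ.suc-* (+ m) x) (suc-·ᵥ m f)

neg-distribˡ-·ᵥ : ∀ {n} k (f : ℤ^ n) → (ℤ.- k) ·ᵥ f ≡ -ᵥ (k ·ᵥ f)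
neg-distribˡ-·ᵥ k f =
  trans (map-cong (λ x → sym (ℤₚ.neg-distribˡ-* k x)) f) (map-∘ ℤ.-_ (k ℤ.*_) f)

record IsSubgroup {n} (P : ℤ^ n → Set) : Set where
  field
    0ᵥ-closed : P 0ᵥ
    +ᵥ-closed : ∀ {f g} → P f → P g → P (f +ᵥ g)
    -ᵥ-closed : ∀ {f} → P f → P (-ᵥ f)

  ℕ·ᵥ-closed : ∀ m {f} → P f → P ((+ m) ·ᵥ f)
  ℕ·ᵥ-closed zero    p = subst P (sym (·ᵥ-zeroˡ _)) 0ᵥ-closed
  ℕ·ᵥ-closed (suc m) p = subst P (sym (suc-·ᵥ m _)) (+ᵥ-closed p (ℕ·ᵥ-closed m p))

  ·ᵥ-closed : ∀ k {f} → P f → P (k ·ᵥ f)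
  ·ᵥ-closed (+ m)    p = ℕ·ᵥ-closed m p
  ·ᵥ-closed -[1+ m ] p =
    subst P (sym (neg-distribˡ-·ᵥ (+ suc m) _)) (-ᵥ-closed (ℕ·ᵥ-closed (suc m) p))

-ᵥ-updateAt-0ᵥ : ∀ {n} i a → -ᵥ (0ᵥ {n} [ i ]%= const a) ≡ 0ᵥ [ i ]%= const (ℤ.- a)
-ᵥ-updateAt-0ᵥ i a =
  trans (map-updateAt 0ᵥ i refl) (cong (_[ i ]%= const (ℤ.- a)) ℤ^.ε⁻¹≈ε)

vecOf-negRec : ∀ {n} (v : Record n) → vecOf (negRec v) ≡ -ᵥ vecOf v
vecOf-negRec (plus  , i) = sym (-ᵥ-updateAt-0ᵥ i (+ 1))
vecOf-negRec (minus , i) = sym (-ᵥ-updateAt-0ᵥ i (ℤ.- + 1))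

freq-++ : ∀ {n} (σ τ : Stream n) → freq (σ ++ τ) ≡ freq σ +ᵥ freq τ
freq-++ []      τ = sym (ℤ^.identityˡ (freq τ))
freq-++ (v ∷ σ) τ =
  trans (cong (vecOf v +ᵥ_) (freq-++ σ τ)) (sym (ℤ^.assoc (vecOf v) (freq σ) (freq τ)))

freq-inv : ∀ {n} (σ : Stream n) → freq (inv σ) ≡ -ᵥ freq σ
freq-inv []      = sym ℤ^.ε⁻¹≈ε
freq-inv (v ∷ σ) = begin
  freq (inv σ ++ [ negRec v ])                ≡⟨ freq-++ (inv σ) [ negRec v ] ⟩
  freq (inv σ) +ᵥ (vecOf (negRec v) +ᵥ 0ᵥ)    ≡⟨ cong₂ _+ᵥ_ (freq-inv σ) (ℤ^.identityʳ _) ⟩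
  (-ᵥ freq σ) +ᵥ vecOf (negRec v)             ≡⟨ cong ((-ᵥ freq σ) +ᵥ_) (vecOf-negRec v) ⟩
  (-ᵥ freq σ) +ᵥ (-ᵥ vecOf v)                 ≡⟨ ℤ^.⁻¹-anti-homo-∙ (vecOf v) (freq σ) ⟨
  -ᵥ (vecOf v +ᵥ freq σ)                      ∎
  where open ≡-Reasoning

IsFrequency : ∀ {n} → ℤ^ n → Set
IsFrequency {n} f = ∃ λ (σ : Stream n) → freq σ ≡ f

isFrequency-isSubgroup : ∀ {n} → IsSubgroup (IsFrequency {n})
isFrequency-isSubgroup = record
  { 0ᵥ-closed = [] , refl
  ; +ᵥ-closed = λ (σ , p) (τ , q) → σ ++ τ , trans (freq-++ σ τ) (cong₂ _+ᵥ_ p q)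
  ; -ᵥ-closed = λ (σ , p) → inv σ , trans (freq-inv σ) (cong (λ f → -ᵥ f) p)
  }

liftRecord : ∀ {n} → Record n → Record (suc n)
liftRecord (s , i) = s , suc i

vecOf-liftRecord : ∀ {n} (v : Record n) → vecOf (liftRecord v) ≡ + 0 ∷ vecOf v
vecOf-liftRecord (plus  , i) = refl
vecOf-liftRecord (minus , i) = refl

freq-map-liftRecord : ∀ {n} (σ : Stream n) → freq (List.map liftRecord σ) ≡ + 0 ∷ freq σ
freq-map-liftRecord []      = refl
freq-map-liftRecord (v ∷ σ) = cong₂ _+ᵥ_ (vecOf-liftRecord v) (freq-map-liftRecord σ)

freq-surjective : ∀ {n} (f : ℤ^ n) → IsFrequency f
freq-surjective []      = [] , refl
freq-surjective (x ∷ f) =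
  subst IsFrequency (cong₂ _∷_ (ℤₚ.+-identityʳ x) (ℤ^.identityˡ f)) (+ᵥ-closed head tail)
  where
  open IsSubgroup isFrequency-isSubgroup
  head : IsFrequency (x ∷ 0ᵥ)
  head = subst IsFrequency (cong₂ _∷_ (ℤₚ.*-identityʳ x) (·ᵥ-zeroʳ x))
           (·ᵥ-closed x ([ plus , zero ] , ℤ^.identityʳ _))
  tail : IsFrequency (+ 0 ∷ f)
  tail with σ , freqσ ← freq-surjective f =
    List.map liftRecord σ , trans (freq-map-liftRecord σ) (cong (+ 0 ∷_) freqσ)

module StreamAutomatonProperties {n} (A : StreamAutomaton n) where
  open StreamAutomaton A

  ⊕*-++ : ∀ s (σ τ : Stream n) → s ⊕* (σ ++ τ) ≡ (s ⊕* σ) ⊕* τ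
  ⊕*-++ = foldl-++ _⊕_

  module WithInitProperties (o : Config) where
    open WithInit o

    ∈φ-shift : ∀ {s f h} → InM h → s ∈φ f → s ∈φ (h +ᵥ f)
    ∈φ-shift (μ , loopμ , p) (σ , run , q) =
      μ ++ σ , trans (⊕*-++ o μ σ) (trans (cong (_⊕* σ) loopμ) run) ,
      trans (freq-++ μ σ) (cong₂ _+ᵥ_ p q)

    reachable⇒∈φ : ∀ {s} → Reachable s → ∃ (s ∈φ_)
    reachable⇒∈φ (σ , run) = freq σ , σ , run , refl

    ∈φ-surjective : ∀ f → ∃ λ s → Reachable s × s ∈φ f
    ∈φ-surjective f with σ , freqσ ← freq-surjective f = o ⊕* σ , (σ , refl) , (σ , refl , freqσ)

    ∼-refl : ∀ {s} → Reachable s → s ∼ s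
    ∼-refl r with f , s∈φf ← reachable⇒∈φ r = f , s∈φf , s∈φf

    ∼-sym : ∀ {s t} → s ∼ t → t ∼ s
    ∼-sym (f , s∈φf , t∈φf) = f , t∈φf , s∈φf

  module _ (reversible : PathReversible) where

    ⊕*-inv : ∀ {s t} (σ : Stream n) → s ⊕* σ ≡ t → t ⊕* inv σ ≡ s
    ⊕*-inv {s} σ refl = trans (sym (⊕*-++ s σ (inv σ))) (reversible σ s)

    module ReversibleWithInit (o : Config) where
      open WithInit o
      open WithInitProperties o

      InM-isSubgroup : IsSubgroup InM
      InM-isSubgroup = record
        { 0ᵥ-closed = [] , refl , refl
        ; +ᵥ-closed = ∈φ-shift
        ; -ᵥ-closed = λ (σ , loopσ , p) →
            inv σ , ⊕*-inv σ loopσ , trans (freq-inv σ) (cong (λ f → -ᵥ f) p)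
        }

      open IsSubgroup InM-isSubgroup

      InM-swap : ∀ {f g} → InM (f -ᵥ g) → InM (g -ᵥ f)
      InM-swap {f} {g} = subst InM (ℤ^.⁻¹-anti-homo‿- f g) ∘′ -ᵥ-closed

      ∈φ-transport : ∀ {s f g} → InM (f -ᵥ g) → s ∈φ g → s ∈φ f
      ∈φ-transport {f = f} {g} m = subst (_ ∈φ_) (ℤ^.//-rightDividesˡ g f) ∘′ ∈φ-shift m

      ∈φ-⇔ : ∀ {s f g} → InM (f -ᵥ g) → s ∈φ f ⇔ s ∈φ g
      ∈φ-⇔ m = mk⇔ (∈φ-transport (InM-swap m)) (∈φ-transport m)

      ∈φ-cancel : ∀ {s f g} → s ∈φ f → s ∈φ g → InM (f -ᵥ g)
      ∈φ-cancel (σ , runσ , p) (τ , runτ , q) =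
        σ ++ inv τ , trans (⊕*-++ o σ (inv τ)) (trans (cong (_⊕* inv τ) runσ) (⊕*-inv τ runτ)) ,
        trans (freq-++ σ (inv τ)) (cong₂ _+ᵥ_ p (trans (freq-inv τ) (cong (λ f → -ᵥ f) q)))

      ∼-trans : ∀ {s t u} → s ∼ t → t ∼ u → s ∼ u
      ∼-trans (f , s∈φf , t∈φf) (g , t∈φg , u∈φg) =
        f , s∈φf , ∈φ-transport (∈φ-cancel t∈φf t∈φg) u∈φg

      ∼⇒InM : ∀ {s t f g} → s ∈φ f → t ∈φ g → s ∼ t → InM (f -ᵥ g)
      ∼⇒InM s∈φf t∈φg (h , s∈φh , t∈φh) =
        ∈φ-cancel (∈φ-transport (∈φ-cancel s∈φf s∈φh) t∈φh) t∈φg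

      InM⇒∼ : ∀ {s t f g} → s ∈φ f → t ∈φ g → InM (f -ᵥ g) → s ∼ t
      InM⇒∼ s∈φf t∈φg m = _ , s∈φf , ∈φ-transport m t∈φg

lemma14 : ∀ {n : ℕ} (A : StreamAutomaton n) → StreamAutomaton.PathReversible A →
    (o : StreamAutomaton.Config A) →
    let open StreamAutomaton A in let open WithInit o in
    -- 1. M is a submodule of ℤⁿ
    (InM 0ᵥ
      × (∀ f g → InM f → InM g → InM (f +ᵥ g))
      × (∀ (k : ℤ) f → InM f → InM (k ·ᵥ f)))
    -- 2.
    × (∀ f g → InM (f -ᵥ g) → ∀ s → (s ∈φ f ⇔ s ∈φ g))
    × (∀ f g → (∃ λ s → s ∈φ f × s ∈φ g) → InM (f -ᵥ g))
    -- 3. ∼ is an equivalence relation on C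
    × (∀ s → Reachable s → s ∼ s)
    × (∀ s t → Reachable s → Reachable t → s ∼ t → t ∼ s)
    × (∀ s t u → Reachable s → Reachable t → Reachable u → s ∼ t → t ∼ u → s ∼ u)
    -- 4. [s] ↦ f + M is a well-defined bijection C/∼ → ℤⁿ/M
    × (∀ s → Reachable s → ∃ λ f → s ∈φ f)
    × (∀ s t f g → Reachable s → Reachable t → s ∈φ f → t ∈φ g → s ∼ t → InM (f -ᵥ g))
    × (∀ s t f g → Reachable s → Reachable t → s ∈φ f → t ∈φ g → InM (f -ᵥ g) → s ∼ t)
    × (∀ f → ∃ λ s → Reachable s × s ∈φ f)
lemma14 A reversible o =
  (0ᵥ-closed , (λ _ _ → +ᵥ-closed) , (λ k _ → ·ᵥ-closed k)) ,
  (λ _ _ m _ → ∈φ-⇔ m) ,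
  (λ _ _ (_ , s∈φf , s∈φg) → ∈φ-cancel s∈φf s∈φg) ,
  (λ _ → ∼-refl) ,
  (λ _ _ _ _ → ∼-sym) ,
  (λ _ _ _ _ _ _ → ∼-trans) ,
  (λ _ → reachable⇒∈φ) ,
  (λ _ _ _ _ _ _ → ∼⇒InM) ,
  (λ _ _ _ _ _ _ → InM⇒∼) ,
  ∈φ-surjective
  where
  open StreamAutomatonProperties A
  open WithInitProperties o
  open ReversibleWithInit reversible o
  open IsSubgroup InM-isSubgroup
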